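{- For $n\ge 1$, let $F_n(x)=\sum_{i=0}^n\binom{2n-i}{i}x^{n-i}$, $G_n(x)=\sum_{i=0}^n\binom{2n+1-i}{i}x^{n+1-i}$, $H_n(x)=\sum_{i=0}^n\left(\binom{2n-i}{i}+\binom{2n-1-i}{i}\right)x^{n-i}$ and $I_n(x)=\sum_{i=0}^{n-1}\left(\binom{2n-1-i}{i}+\binom{2n-2-i}{i}\right)x^{n-i}$ (these formulas defining $F_m,G_m,H_m,I_m$ for all $m\ge 1$). Then (a) $2xH_n(x)+I_n(x)\preccurlyeq G_{n+1}(x)$; (b) $F_n(x)+2G_n(x)\preccurlyeq H_{n+1}(x)$; (c) $xF_n(x)+G_n(x)=I_{n+1}(x)$.
   Context: Binomial coefficients $\binom{m}{k}$ with $0\le m<k$ are $0$. For polynomials $f(x)=\sum a_ix^i$, $g(x)=\sum b_ix^i$ over $\mathbb{N}_0$, $g(x)\preccurlyeq f(x)$ means $\sum_{k\ge N}a_k\ge\sum_{k\ge N}b_k$ for every nonnegative integer $N$. -}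

module Defs where

open import Data.Nat using (ℕ; zero; suc; _+_; _*_; _∸_; _≤_)
open import Data.Nat.Combinatorics using (_C_)
open import Data.List using (List; []; _∷_; drop; replicate; map; upTo; foldr)
open import Relation.Binary.PropositionalEquality using (_≡_)
open import Data.Nat.ListAction using (sum)

-- Polynomials over ℕ₀ as coefficient lists: [a₀, a₁, a₂, …] represents Σ aᵢ xⁱ.
Poly : Set
Poly = List ℕ

coeff : Poly → ℕ → ℕ
coeff []       _       = 0
coeff (a ∷ _)  zero    = a
coeff (_ ∷ p)  (suc k) = coeff p k

_⊕_ : Poly → Poly → Poly
[]      ⊕ q       = q
p       ⊕ []      = p
(a ∷ p) ⊕ (b ∷ q) = (a + b) ∷ (p ⊕ q)
infixl 6 _⊕_

X·_ : Poly → Poly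
X· p = 0 ∷ p

_⊛_ : ℕ → Poly → Poly
c ⊛ p = map (c *_) p
infixl 7 _⊛_

mono : ℕ → ℕ → Poly
mono c d = replicate d 0 Data.List.++ (c ∷ [])

ΣP : ℕ → (ℕ → Poly) → Poly
ΣP m f = foldr (λ i acc → f i ⊕ acc) [] (upTo (suc m))

-- binomial coefficient (stdlib: m C k = 0 when m < k)
C : ℕ → ℕ → ℕ
C = _C_

F : ℕ → Poly
F n = ΣP n (λ i → mono (C (2 * n ∸ i) i) (n ∸ i))

G : ℕ → Poly
G n = ΣP n (λ i → mono (C (2 * n + 1 ∸ i) i) (n + 1 ∸ i))

H : ℕ → Poly
H n = ΣP n (λ i → mono (C (2 * n ∸ i) i + C (2 * n ∸ 1 ∸ i) i) (n ∸ i))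

I : ℕ → Poly
I n = ΣP (n ∸ 1) (λ i → mono (C (2 * n ∸ 1 ∸ i) i + C (2 * n ∸ 2 ∸ i) i) (n ∸ i))

tailSum : Poly → ℕ → ℕ
tailSum p N = sum (drop N p)

_≼_ : Poly → Poly → Set
g ≼ f = ∀ (N : ℕ) → tailSum g N ≤ tailSum f N
infix 4 _≼_

_≐_ : Poly → Poly → Set
p ≐ q = ∀ (k : ℕ) → coeff p k ≡ coeff q k
infix 4 _≐_

module Submission where

-- Every polynomial F_n, G_n, H_{n+1}, I_{n+1} is a sum of monomials
-- c_i x^{D-i} (i ≤ m) of pairwise distinct degrees, so its coefficient of x^k is
-- the single c_i with k + i = D.  Rewriting the binomial C(2n-i, i) with i = n - k
-- by symmetry gives closed forms: [x^k] F_n = C(n+k, 2k) =: φ n k and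
-- [x^k] G_n = C(n+k, 2k-1) =: γ n k (0 for k = 0), with
-- [x^k] H_{n+1} = φ (n+1) k + γ n k and [x^k] I_{n+1} = γ n k + φ n (k-1).
-- Pascal's rule turns into the recurrences F_{n+1} = F_n + G_n and
-- G_{n+1} = x F_{n+1} + G_n.  Then
--   (c) is the closed form of I_{n+1};
--   (b) is even an equality: F_n + 2 G_n = F_{n+1} + G_n = H_{n+1};
--   (a) follows from the identity 2x H_n + I_n + x (x F_n) = G_{n+1} + x F_n,
--       since multiplying by x can only increase every tail sum.

open import Defs
open import Data.Nat using (ℕ; zero; suc; _+_; _*_; _∸_; _≤_; _<_; _≥_; z≤n; s≤s; z<s; s<s; s≤s⁻¹; s<s⁻¹; _≤?_)
open import Data.Nat.Properties
open import Data.Nat.Combinatorics using (nCk≡nC[n∸k]; nCk+nC[k+1]≡[n+1]C[k+1]; k>n⇒nCk≡0)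
open import Data.Nat.ListAction using (sum)
open import Data.Nat.Tactic.RingSolver using (solve-∀)
open import Data.List using ([]; _∷_; drop; map; foldr; applyUpTo; upTo)
open import Data.List.Properties using (map-upTo)
open import Data.Product using (_×_; _,_)
open import Data.Empty using (⊥-elim)
open import Function using (_∘_)
open import Relation.Nullary using (yes; no)
open import Relation.Binary.PropositionalEquality
  using (_≡_; _≢_; refl; sym; trans; cong; cong₂; subst; module ≡-Reasoning)

coeff-⊕ : ∀ p q k → coeff (p ⊕ q) k ≡ coeff p k + coeff q k
coeff-⊕ []      q       k       = refl
coeff-⊕ (a ∷ p) []      k       = sym (+-identityʳ _)
coeff-⊕ (a ∷ p) (b ∷ q) zero    = refl
coeff-⊕ (a ∷ p) (b ∷ q) (suc k) = coeff-⊕ p q k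

coeff-⊛ : ∀ c p k → coeff (c ⊛ p) k ≡ c * coeff p k
coeff-⊛ c []      k       = sym (*-zeroʳ c)
coeff-⊛ c (a ∷ p) zero    = refl
coeff-⊛ c (a ∷ p) (suc k) = coeff-⊛ c p k

coeff-mono-≡ : ∀ c d → coeff (mono c d) d ≡ c
coeff-mono-≡ c zero    = refl
coeff-mono-≡ c (suc d) = coeff-mono-≡ c d

coeff-mono-≢ : ∀ c {d k} → d ≢ k → coeff (mono c d) k ≡ 0
coeff-mono-≢ c {zero}  {zero}  d≢k = ⊥-elim (d≢k refl)
coeff-mono-≢ c {zero}  {suc k} d≢k = refl
coeff-mono-≢ c {suc d} {zero}  d≢k = refl
coeff-mono-≢ c {suc d} {suc k} d≢k = coeff-mono-≢ c (d≢k ∘ cong suc)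

coeff-ΣP : ∀ (f : ℕ → Poly) m k → coeff (ΣP m f) k ≡ sum (applyUpTo (λ i → coeff (f i) k) (suc m))
coeff-ΣP f m k = trans (coeff-foldr (upTo (suc m))) (cong sum (map-upTo _ (suc m)))
  where
  coeff-foldr : ∀ xs → coeff (foldr (λ i acc → f i ⊕ acc) [] xs) k ≡ sum (map (λ i → coeff (f i) k) xs)
  coeff-foldr []       = refl
  coeff-foldr (i ∷ xs) = trans (coeff-⊕ (f i) _ k) (cong (coeff (f i) k +_) (coeff-foldr xs))

sum-zero : ∀ (b : ℕ → ℕ) n → (∀ i → i < n → b i ≡ 0) → sum (applyUpTo b n) ≡ 0
sum-zero b zero    _      = refl
sum-zero b (suc n) vanish =
  cong₂ _+_ (vanish 0 z<s) (sum-zero (b ∘ suc) n (λ i i<n → vanish (suc i) (s<s i<n)))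

sum-single : ∀ (b : ℕ → ℕ) n t → t < n → (∀ i → i < n → i ≢ t → b i ≡ 0) → sum (applyUpTo b n) ≡ b t
sum-single b (suc n) zero    _   vanish =
  trans (cong (b 0 +_) (sum-zero (b ∘ suc) n (λ i i<n → vanish (suc i) (s<s i<n) λ ()))) (+-identityʳ (b 0))
sum-single b (suc n) (suc t) t<n vanish =
  cong₂ _+_ (vanish 0 z<s λ ()) (sum-single (b ∘ suc) n t (s<s⁻¹ t<n)
    (λ i i<n i≢t → vanish (suc i) (s<s i<n) (i≢t ∘ suc-injective)))

term-hit : ∀ c {k u D} → k + u ≡ D → coeff (mono c (D ∸ u)) k ≡ c
term-hit c {k} {u} refl = subst (λ d → coeff (mono c d) k ≡ c) (sym (m+n∸n≡m k u)) (coeff-mono-≡ c k)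

term-miss : ∀ c {k i D} → i ≤ D → k + i ≢ D → coeff (mono c (D ∸ i)) k ≡ 0
term-miss c {k} {i} {D} i≤D k+i≢D = coeff-mono-≢ c {D ∸ i} {k} (λ e → k+i≢D (trans (cong (_+ _) (sym e)) (m∸n+n≡m i≤D)))

module _ (c : ℕ → ℕ) {m D : ℕ} (m≤D : m ≤ D) where

  private
    T : ℕ → Poly
    T i = mono (c i) (D ∸ i)

  ΣP-hit : ∀ {k u} → k + u ≡ D → u ≤ m → coeff (ΣP m T) k ≡ c u
  ΣP-hit {k} {u} k+u≡D u≤m = trans (coeff-ΣP T m k)
    (trans (sum-single (λ i → coeff (T i) k) (suc m) u (s≤s u≤m) others) (term-hit (c u) {k} {u} {D} k+u≡D))
    where
    others : ∀ i → i < suc m → i ≢ u → coeff (T i) k ≡ 0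
    others i i<sm i≢u = term-miss (c i) (≤-trans (s≤s⁻¹ i<sm) m≤D)
      (λ k+i≡D → i≢u (+-cancelˡ-≡ k i u (trans k+i≡D (sym k+u≡D))))

  ΣP-miss : ∀ {k} → (∀ u → u ≤ m → k + u ≢ D) → coeff (ΣP m T) k ≡ 0
  ΣP-miss {k} none = trans (coeff-ΣP T m k) (sum-zero (λ i → coeff (T i) k) (suc m)
    (λ i i<sm → term-miss (c i) (≤-trans (s≤s⁻¹ i<sm) m≤D) (none i (s≤s⁻¹ i<sm))))

  coeff-ΣP-mono : ∀ (a : ℕ → ℕ) →
    (∀ k u → k + u ≡ D → u ≤ m → c u ≡ a k) →
    (∀ k → D < k → a k ≡ 0) →
    (∀ k → k + m < D → a k ≡ 0) →
    ∀ k → coeff (ΣP m T) k ≡ a k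
  coeff-ΣP-mono a term above below k with k ≤? D
  ... | no k≰D = trans (ΣP-miss (λ u _ k+u≡D → k≰D (subst (k ≤_) k+u≡D (m≤m+n k u))))
                       (sym (above k (≰⇒> k≰D)))
  ... | yes k≤D with m≤n⇒∃[o]m+o≡n k≤D
  ...   | u , k+u≡D with u ≤? m
  ...     | yes u≤m = trans (ΣP-hit k+u≡D u≤m) (term k u k+u≡D u≤m)
  ...     | no u≰m  = trans (ΣP-miss (λ v v≤m k+v≡D → u≰m (subst (_≤ m) (same k+v≡D) v≤m)))
                            (sym (below k (subst (k + m <_) k+u≡D (+-monoʳ-< k (≰⇒> u≰m)))))
    where
    same : ∀ {v} → k + v ≡ D → v ≡ u
    same k+v≡D = +-cancelˡ-≡ k _ _ (trans k+v≡D (sym k+u≡D))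

coeff-drop : ∀ N p k → coeff (drop N p) k ≡ coeff p (N + k)
coeff-drop zero    p       k = refl
coeff-drop (suc N) []      k = refl
coeff-drop (suc N) (a ∷ p) k = coeff-drop N p k

sum-⊕ : ∀ p q → sum (p ⊕ q) ≡ sum p + sum q
sum-⊕ []      q       = refl
sum-⊕ (a ∷ p) []      = sym (+-identityʳ _)
sum-⊕ (a ∷ p) (b ∷ q) = trans (cong (a + b +_) (sum-⊕ p q)) (+-assoc-swap a b (sum p) (sum q))
  where
  +-assoc-swap : ∀ a b x y → a + b + (x + y) ≡ a + x + (b + y)
  +-assoc-swap = solve-∀

sum-≐ : ∀ p q → p ≐ q → sum p ≡ sum q
sum-≐ []      []      p≐q = refl
sum-≐ []      (b ∷ q) p≐q = cong₂ _+_ (p≐q 0) (sum-≐ [] q (p≐q ∘ suc))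
sum-≐ (a ∷ p) []      p≐q = cong₂ _+_ (p≐q 0) (sum-≐ p [] (p≐q ∘ suc))
sum-≐ (a ∷ p) (b ∷ q) p≐q = cong₂ _+_ (p≐q 0) (sum-≐ p q (p≐q ∘ suc))

drop-⊕ : ∀ N p q → drop N (p ⊕ q) ≡ drop N p ⊕ drop N q
drop-⊕ zero    p       q       = refl
drop-⊕ (suc N) []      q       = refl
drop-⊕ (suc N) (a ∷ p) []      = sym (⊕-[] (drop N p))
  where
  ⊕-[] : ∀ p → p ⊕ [] ≡ p
  ⊕-[] []      = refl
  ⊕-[] (a ∷ p) = refl
drop-⊕ (suc N) (a ∷ p) (b ∷ q) = drop-⊕ N p q

tail-⊕ : ∀ p q N → tailSum (p ⊕ q) N ≡ tailSum p N + tailSum q N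
tail-⊕ p q N = trans (cong sum (drop-⊕ N p q)) (sum-⊕ (drop N p) (drop N q))

tail-≐ : ∀ {p q} → p ≐ q → ∀ N → tailSum p N ≡ tailSum q N
tail-≐ {p} {q} p≐q N = sum-≐ (drop N p) (drop N q)
  (λ k → trans (coeff-drop N p k) (trans (p≐q (N + k)) (sym (coeff-drop N q k))))

-- Tail sums decrease as the cut-off grows, hence multiplying by x increases them.
tail-suc : ∀ p N → tailSum p (suc N) ≤ tailSum p N
tail-suc []      N       = z≤n
tail-suc (a ∷ p) zero    = m≤n+m (sum p) a
tail-suc (a ∷ p) (suc N) = tail-suc p N

tail-X : ∀ p N → tailSum p N ≤ tailSum (X· p) N
tail-X p zero    = ≤-refl
tail-X p (suc N) = tail-suc p N

≐⇒≼ : ∀ {p q} → p ≐ q → p ≼ q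
≐⇒≼ p≐q N = ≤-reflexive (tail-≐ p≐q N)

≼-from-shift : ∀ p q r → p ⊕ X· r ≐ q ⊕ r → p ≼ q
≼-from-shift p q r eq N = +-cancelʳ-≤ (tailSum (X· r) N) (tailSum p N) (tailSum q N) (begin
  tailSum p N + tailSum (X· r) N ≡⟨ tail-⊕ p (X· r) N ⟨
  tailSum (p ⊕ X· r) N           ≡⟨ tail-≐ eq N ⟩
  tailSum (q ⊕ r) N              ≡⟨ tail-⊕ q r N ⟩
  tailSum q N + tailSum r N      ≤⟨ +-monoʳ-≤ (tailSum q N) (tail-X r N) ⟩
  tailSum q N + tailSum (X· r) N ∎)
  where open ≤-Reasoning

C-term : ∀ a u N → a + u + u ≡ N → C (N ∸ u) u ≡ C (a + u) a
C-term a u _ refl = trans (cong (λ M → C M u) (m+n∸n≡m (a + u) u))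
  (trans (nCk≡nC[n∸k] (m≤n+m u a)) (cong (C (a + u)) (m+n∸n≡m a u)))

φ : ℕ → ℕ → ℕ
φ n k = C (n + k) (k + k)

γ : ℕ → ℕ → ℕ
γ n zero    = 0
γ n (suc j) = C (n + suc j) (suc (j + j))

xφ : ℕ → ℕ → ℕ
xφ n zero    = 0
xφ n (suc k) = φ n k

φ-vanish : ∀ {n k} → n < k → φ n k ≡ 0
φ-vanish {n} {k} n<k = k>n⇒nCk≡0 (+-monoˡ-< k n<k)

γ-vanish : ∀ {n k} → suc n < k → γ n k ≡ 0
γ-vanish {n} {suc j} (s<s n<j) =
  k>n⇒nCk≡0 (subst (_< suc (j + j)) (sym (+-suc n j)) (s<s (+-monoˡ-< j n<j)))

φ-step : ∀ n k → φ (suc n) k ≡ φ n k + γ n k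
φ-step n zero    = refl
φ-step n (suc j) = begin
  C (suc (n + suc j)) (suc (j + suc j))                 ≡⟨ nCk+nC[k+1]≡[n+1]C[k+1] (n + suc j) (j + suc j) ⟨
  C (n + suc j) (j + suc j) + φ n (suc j)               ≡⟨ +-comm _ (φ n (suc j)) ⟩
  φ n (suc j) + C (n + suc j) (j + suc j)               ≡⟨ cong (λ K → φ n (suc j) + C (n + suc j) K) (+-suc j j) ⟩
  φ n (suc j) + γ n (suc j)                             ∎
  where open ≡-Reasoning

γ-step : ∀ n k → γ (suc n) k ≡ xφ (suc n) k + γ n k
γ-step n zero    = refl
γ-step n (suc j) = begin
  C (suc (n + suc j)) (suc (j + j))                     ≡⟨ nCk+nC[k+1]≡[n+1]C[k+1] (n + suc j) (j + j) ⟨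
  C (n + suc j) (j + j) + γ n (suc j)                   ≡⟨ cong (λ N → C N (j + j) + γ n (suc j)) (+-suc n j) ⟩
  φ (suc n) j + γ n (suc j)                             ∎
  where open ≡-Reasoning

F-term : ∀ {n} k u → k + u ≡ n → C (2 * n ∸ u) u ≡ φ n k
F-term k u refl = trans (C-term (k + k) u (2 * (k + u)) (double k u))
                        (cong (λ N → C N (k + k)) (rearrange k u))
  where
  double : ∀ k u → k + k + u + u ≡ 2 * (k + u)
  double = solve-∀
  rearrange : ∀ k u → k + k + u ≡ k + u + k
  rearrange = solve-∀

G-term : ∀ {n} k u → k + u ≡ suc n → C (2 * n + 1 ∸ u) u ≡ γ n k
G-term {n} zero    u refl = trans (cong (λ N → C N (suc n)) (lower n)) (k>n⇒nCk≡0 (n<1+n n))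
  where
  lower : ∀ n → 2 * n + 1 ∸ suc n ≡ n
  lower n = trans (cong (_∸ suc n) (split n)) (m+n∸n≡m n (suc n))
    where
    split : ∀ n → 2 * n + 1 ≡ n + suc n
    split = solve-∀
G-term     (suc j) u refl = trans (C-term (suc (j + j)) u (2 * (j + u) + 1) (double j u))
                                  (cong (λ N → C N (suc (j + j))) (rearrange j u))
  where
  double : ∀ j u → suc (j + j) + u + u ≡ 2 * (j + u) + 1
  double = solve-∀
  rearrange : ∀ j u → suc (j + j) + u ≡ j + u + suc j
  rearrange = solve-∀

2[1+n]∸1 : ∀ n → 2 * suc n ∸ 1 ≡ 2 * n + 1
2[1+n]∸1 n = trans (cong (_∸ 1) (expand n)) (m+n∸n≡m (2 * n + 1) 1)
  where
  expand : ∀ n → 2 * suc n ≡ 2 * n + 1 + 1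
  expand = solve-∀

2[1+n]∸2 : ∀ n → 2 * suc n ∸ 2 ≡ 2 * n
2[1+n]∸2 n = trans (cong (_∸ 2) (expand n)) (m+n∸n≡m (2 * n) 2)
  where
  expand : ∀ n → 2 * suc n ≡ 2 * n + 2
  expand = solve-∀

H-term : ∀ {n} k u → k + u ≡ suc n →
  C (2 * suc n ∸ u) u + C (2 * suc n ∸ 1 ∸ u) u ≡ φ (suc n) k + γ n k
H-term {n} k u eq = cong₂ _+_ (F-term k u eq)
  (trans (cong (λ N → C (N ∸ u) u) (2[1+n]∸1 n)) (G-term k u eq))

I-term : ∀ {n} k u → k + u ≡ suc n → u ≤ n →
  C (2 * suc n ∸ 1 ∸ u) u + C (2 * suc n ∸ 2 ∸ u) u ≡ γ n k + xφ n k
I-term {n} zero    u refl u≤n = ⊥-elim (n≮n n u≤n)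
I-term {n} (suc j) u eq   _   = cong₂ _+_
  (trans (cong (λ N → C (N ∸ u) u) (2[1+n]∸1 n)) (G-term (suc j) u eq))
  (trans (cong (λ N → C (N ∸ u) u) (2[1+n]∸2 n)) (F-term j u (suc-injective eq)))

coeff-F : ∀ n k → coeff (F n) k ≡ φ n k
coeff-F n = coeff-ΣP-mono (λ i → C (2 * n ∸ i) i) ≤-refl (φ n)
  (λ k u eq _ → F-term k u eq)
  (λ _ → φ-vanish)
  (λ k k+n<n → ⊥-elim (m+n≮n k n k+n<n))

coeff-XF : ∀ n k → coeff (X· F n) k ≡ xφ n k
coeff-XF n zero    = refl
coeff-XF n (suc k) = coeff-F n k

coeff-G : ∀ n k → coeff (G n) k ≡ γ n k
coeff-G n = coeff-ΣP-mono (λ i → C (2 * n + 1 ∸ i) i) (m≤m+n n 1) (γ n)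
  (λ k u eq _ → G-term k u (trans eq (+-comm n 1)))
  (λ k n+1<k → γ-vanish (subst (_< k) (+-comm n 1) n+1<k))
  below
  where
  below : ∀ k → k + n < n + 1 → γ n k ≡ 0
  below zero    _  = refl
  below (suc j) lt = ⊥-elim (m+n≮n j n (s<s⁻¹ (subst (suc j + n <_) (+-comm n 1) lt)))

coeff-H : ∀ n k → coeff (H (suc n)) k ≡ φ (suc n) k + γ n k
coeff-H n = coeff-ΣP-mono _ ≤-refl (λ k → φ (suc n) k + γ n k)
  (λ k u eq _ → H-term k u eq)
  (λ k n+1<k → cong₂ _+_ (φ-vanish n+1<k) (γ-vanish n+1<k))
  (λ k lt → ⊥-elim (m+n≮n k (suc n) lt))

coeff-I : ∀ n k → coeff (I (suc n)) k ≡ γ n k + xφ n k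
coeff-I n = coeff-ΣP-mono _ (n≤1+n n) (λ k → γ n k + xφ n k)
  I-term
  above
  below
  where
  above : ∀ k → suc n < k → γ n k + xφ n k ≡ 0
  above (suc j) n+1<k = cong₂ _+_ (γ-vanish n+1<k) (φ-vanish (s<s⁻¹ n+1<k))
  below : ∀ k → k + n < suc n → γ n k + xφ n k ≡ 0
  below zero    _  = refl
  below (suc j) lt = ⊥-elim (m+n≮n j n (s<s⁻¹ lt))

part-c : ∀ n → X· F n ⊕ G n ≐ I (suc n)
part-c n k = begin
  coeff (X· F n ⊕ G n) k ≡⟨ coeff-⊕ (X· F n) (G n) k ⟩
  coeff (X· F n) k + coeff (G n) k ≡⟨ cong₂ _+_ (coeff-XF n k) (coeff-G n k) ⟩
  xφ n k + γ n k         ≡⟨ +-comm (xφ n k) (γ n k) ⟩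
  γ n k + xφ n k         ≡⟨ coeff-I n k ⟨
  coeff (I (suc n)) k    ∎
  where open ≡-Reasoning

part-b : ∀ n → F n ⊕ 2 ⊛ G n ≐ H (suc n)
part-b n k = begin
  coeff (F n ⊕ 2 ⊛ G n) k ≡⟨ coeff-⊕ (F n) (2 ⊛ G n) k ⟩
  coeff (F n) k + coeff (2 ⊛ G n) k
    ≡⟨ cong₂ _+_ (coeff-F n k) (trans (coeff-⊛ 2 (G n) k) (cong (2 *_) (coeff-G n k))) ⟩
  φ n k + 2 * γ n k       ≡⟨ twice (φ n k) (γ n k) ⟩
  φ n k + γ n k + γ n k   ≡⟨ cong (_+ γ n k) (φ-step n k) ⟨
  φ (suc n) k + γ n k     ≡⟨ coeff-H n k ⟨
  coeff (H (suc n)) k     ∎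
  where
  open ≡-Reasoning
  twice : ∀ f g → f + 2 * g ≡ f + g + g
  twice = solve-∀

-- (a) The coefficient identity behind 2x H_{m+1} + I_{m+1} + x² F_{m+1} = G_{m+2} + x F_{m+1},
-- in degree k+1, after expanding with the recurrences down to level m.
part-a-coeff : ∀ m k → 2 * (φ (suc m) k + γ m k) + (γ m (suc k) + φ m k) + xφ (suc m) k
                     ≡ γ (suc (suc m)) (suc k) + φ (suc m) k
part-a-coeff m k
  rewrite γ-step (suc m) (suc k) | φ-step (suc m) k | γ-step m (suc k) | γ-step m k | φ-step m k
  = expand (φ m k) (γ m k) (γ m (suc k)) (xφ (suc m) k)
  where
  expand : ∀ f g g′ s → 2 * (f + g + g) + (g′ + f) + s ≡ f + g + (s + g) + (f + g + g′) + (f + g)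
  expand = solve-∀

part-a-identity : ∀ m → (2 ⊛ X· H (suc m) ⊕ I (suc m)) ⊕ X· (X· F (suc m))
                      ≐ G (suc (suc m)) ⊕ X· F (suc m)
part-a-identity m k = begin
  coeff ((2 ⊛ X· H (suc m) ⊕ I (suc m)) ⊕ X· (X· F (suc m))) k
    ≡⟨ coeff-⊕ (2 ⊛ X· H (suc m) ⊕ I (suc m)) _ k ⟩
  coeff (2 ⊛ X· H (suc m) ⊕ I (suc m)) k + coeff (X· (X· F (suc m))) k
    ≡⟨ cong (_+ coeff (X· (X· F (suc m))) k) (coeff-⊕ (2 ⊛ X· H (suc m)) (I (suc m)) k) ⟩
  coeff (2 ⊛ X· H (suc m)) k + coeff (I (suc m)) k + coeff (X· (X· F (suc m))) k
    ≡⟨ by-degree k ⟩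
  coeff (G (suc (suc m))) k + coeff (X· F (suc m)) k
    ≡⟨ coeff-⊕ (G (suc (suc m))) (X· F (suc m)) k ⟨
  coeff (G (suc (suc m)) ⊕ X· F (suc m)) k ∎
  where
  open ≡-Reasoning
  by-degree : ∀ k → coeff (2 ⊛ X· H (suc m)) k + coeff (I (suc m)) k + coeff (X· (X· F (suc m))) k
                  ≡ coeff (G (suc (suc m))) k + coeff (X· F (suc m)) k
  by-degree zero rewrite coeff-I m 0 | coeff-G (suc (suc m)) 0 = refl
  by-degree (suc k)
    rewrite coeff-⊛ 2 (H (suc m)) k | coeff-H m k | coeff-I m (suc k)
          | coeff-G (suc (suc m)) (suc k) | coeff-XF (suc m) k | coeff-F (suc m) k
    = part-a-coeff m k

proposition3p15 : ∀ (n : ℕ) → n ≥ 1 →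
      ((2 ⊛ (X· H n)) ⊕ I n ≼ G (n + 1))
    × (F n ⊕ (2 ⊛ G n) ≼ H (n + 1))
    × ((X· F n) ⊕ G n ≐ I (n + 1))
proposition3p15 (suc m) _ =
    subst (λ N → 2 ⊛ X· H (suc m) ⊕ I (suc m) ≼ G N) 2+m≡m+2 (≼-from-shift _ _ (X· F (suc m)) (part-a-identity m))
  , subst (λ N → F (suc m) ⊕ 2 ⊛ G (suc m) ≼ H N) 2+m≡m+2 (≐⇒≼ (part-b (suc m)))
  , subst (λ N → X· F (suc m) ⊕ G (suc m) ≐ I N) 2+m≡m+2 (part-c (suc m))
  where
  2+m≡m+2 : suc (suc m) ≡ suc m + 1
  2+m≡m+2 = +-comm 1 (suc m)
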